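{- Let $R$ be a commutative ring with identity, let $A,B\in R$ and $\varepsilon\in\{1,-1\}$. Suppose that $w_{ -1}=\varepsilon$, $w_0=1$, and $w_{n+1}=Aw_n-Bw_{n-1}$ for all $n\in\{0,1,2,\ldots\}$. Then for any positive integer $n$, $$\det[w_{|j-k|}]_{1\le j,k\le n}=u_n\big(1-(A-\varepsilon B)^2,\ B^2(1+B-\varepsilon A)^2\big).$$
   Context: For elements $x,y$ of a commutative ring with identity, the Lucas sequence $(u_n(x,y))_{n\ge0}$ is defined by $u_0(x,y)=0$, $u_1(x,y)=1$, and $u_{n+1}(x,y)=xu_n(x,y)-yu_{n-1}(x,y)$ for $n\ge1$. -}

module Defs where

open import Level using (Level)
open import Algebra.Bundles using (CommutativeRing)
open import Data.Nat using (ℕ; zero; suc)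
open import Data.Fin using (Fin; zero; suc; punchIn)
open import Function using (_∘_)

module _ {c ℓ : Level} (R : CommutativeRing c ℓ) where
  open CommutativeRing R hiding (zero)

  lucasU : Carrier → Carrier → ℕ → Carrier
  lucasU x y zero = 0#
  lucasU x y (suc zero) = 1#
  lucasU x y (suc (suc n)) = x * lucasU x y (suc n) - y * lucasU x y n

  altSum : {n : ℕ} → (Fin n → Carrier) → Carrier
  altSum {zero} f = 0#
  altSum {suc n} f = f zero - altSum (f ∘ suc)

  det : {n : ℕ} → (Fin n → Fin n → Carrier) → Carrier
  det {zero} M = 1#
  det {suc n} M = altSum (λ i → M i zero * det (λ j k → M (punchIn i j) (suc k)))

{-# OPTIONS --safe #-}
module Submission where

-- Write T for the matrix [w_|j−k|].  From the third row on, adding −A times the previous row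
-- and B times the one before it leaves the determinant unchanged, and by the recurrence it
-- clears everything below the subdiagonal of T.  The same operations on the columns (through
-- the transpose) produce a matrix that is again symmetric, since T is, and hence tridiagonal:
-- its diagonal is 1, 1, x, x, … and its off-diagonal w₁, γ, γ, … with w₁ = A − εB,
-- γ = w₁ − A + Bw₁, x = 1 − w₁² and, because ε² = 1, γ² = y.  Expanding along the first
-- column, the leading minors of such a matrix satisfy D_{n+1} = x D_n − y D_{n−1}, with
-- D₁ = 1 and D₂ = x: the Lucas recurrence.

open import Defs
open import Level using (Level)
open import Algebra.Bundles using (CommutativeRing)
open import Data.Nat using (ℕ; suc; _≤_; ∣_-_∣)
open import Data.Fin using (Fin; toℕ)
open import Data.Integer using (ℤ; +_; -[1+_])
open import Data.Sum using (_⊎_)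

open import Algebra.Bundles using (RawRing)
open import Algebra.Solver.Ring.AlmostCommutativeRing using (_-Raw-AlmostCommutative⟶_; fromCommutativeRing)
open import Data.Nat as ℕ using (zero)
open import Data.Nat.Properties
  using (_<?_; ≤-total; <⇒≢; <-irrefl; <-trans; <-≤-trans; ≮⇒≥; n<1+n; m<n⇒m<1+n; m<1+n⇒m<n∨m≡n; ∣-∣-comm)
open import Data.Fin using (zero; suc; punchIn; punchOut; inject₁; fromℕ<)
open import Data.Fin.Properties
  using (_≟_; suc-injective; punchInᵢ≢i; punchOut-punchIn; punchOut-cong; punchIn-punchOut;
         toℕ-injective; toℕ-fromℕ<; toℕ-inject₁; toℕ<n)
open import Data.Sum using (inj₁; inj₂; [_,_]′)
open import Data.Product using (∃; _×_; _,_)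
open import Data.Product.Properties using (≡-dec)
open import Data.Maybe using (Maybe; just; nothing)
open import Function using (_∘_)
open import Relation.Nullary using (yes; no; ¬_; contradiction)
open import Relation.Binary.PropositionalEquality as ≡ using (_≡_; _≢_)

module IntegerCoefficients {c ℓ : Level} (R : CommutativeRing c ℓ) where
  open CommutativeRing R hiding (zero)
  open import Algebra.Properties.Semiring.Mult.TCOptimised semiring
    using (×-homo-+; ×1-homo-*; 1+×) renaming (_×_ to _·_)
  open import Algebra.Properties.Ring ring using (-0#≈0#; x[y-z]≈xy-xz; [y-z]x≈yx-zx)
  open import Algebra.Properties.AbelianGroup +-abelianGroup using (⁻¹-∙-comm; ⁻¹-anti-homo‿-)
  open import Algebra.Properties.CommutativeSemigroup +-commutativeSemigroup using (interchange)
  open import Relation.Binary.Reasoning.Setoid setoid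

  -- The integer a − b, kept in the normal form where a or b is zero, so that equal integers
  -- are represented by equal pairs.
  canonical : ℕ × ℕ → ℕ × ℕ
  canonical (suc a , suc b) = canonical (a , b)
  canonical p               = p

  ℤ-rawRing : RawRing _ _
  ℤ-rawRing = record
    { Carrier = ℕ × ℕ
    ; _≈_     = _≡_
    ; _+_     = λ { (a , b) (a′ , b′) → canonical (a ℕ.+ a′ , b ℕ.+ b′) }
    ; _*_     = λ { (a , b) (a′ , b′) → canonical (a ℕ.* a′ ℕ.+ b ℕ.* b′ , a ℕ.* b′ ℕ.+ b ℕ.* a′) }
    ; -_      = λ { (a , b) → (b , a) }
    ; 0#      = (0 , 0)
    ; 1#      = (1 , 0)
    }

  private
    infix 8 _⊖_
    _⊖_ : ℕ → ℕ → Carrier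
    a ⊖ b = a · 1# - b · 1#

    -‿+-interchange : ∀ x y z u → (x - y) + (z - u) ≈ (x + z) - (y + u)
    -‿+-interchange x y z u = trans (interchange x (- y) z (- u)) (+-congˡ (⁻¹-∙-comm y u))

    ⊖-suc : ∀ a b → suc a ⊖ suc b ≈ a ⊖ b
    ⊖-suc a b = begin
      suc a · 1# - suc b · 1#          ≈⟨ +-cong (1+× a 1#) (-‿cong (1+× b 1#)) ⟩
      (1# + a · 1#) - (1# + b · 1#)    ≈⟨ -‿+-interchange 1# 1# _ _ ⟨
      (1# - 1#) + a ⊖ b                ≈⟨ +-congʳ (-‿inverseʳ 1#) ⟩
      0# + a ⊖ b                       ≈⟨ +-identityˡ _ ⟩
      a ⊖ b                            ∎

    ⊖-homo-+ : ∀ a b a′ b′ → (a ℕ.+ a′) ⊖ (b ℕ.+ b′) ≈ a ⊖ b + a′ ⊖ b′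
    ⊖-homo-+ a b a′ b′ = begin
      (a ℕ.+ a′) · 1# - (b ℕ.+ b′) · 1#         ≈⟨ +-cong (×-homo-+ 1# a a′) (-‿cong (×-homo-+ 1# b b′)) ⟩
      (a · 1# + a′ · 1#) - (b · 1# + b′ · 1#)   ≈⟨ -‿+-interchange _ _ _ _ ⟨
      a ⊖ b + a′ ⊖ b′                           ∎

    ⊖-homo-* : ∀ a b a′ b′ →
               (a ℕ.* a′ ℕ.+ b ℕ.* b′) ⊖ (a ℕ.* b′ ℕ.+ b ℕ.* a′) ≈ (a ⊖ b) * (a′ ⊖ b′)
    ⊖-homo-* a b a′ b′ = begin
      (a ℕ.* a′ ℕ.+ b ℕ.* b′) ⊖ (a ℕ.* b′ ℕ.+ b ℕ.* a′)
        ≈⟨ ⊖-homo-+ (a ℕ.* a′) (a ℕ.* b′) (b ℕ.* b′) (b ℕ.* a′) ⟩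
      (a ℕ.* a′) ⊖ (a ℕ.* b′) + (b ℕ.* b′) ⊖ (b ℕ.* a′)
        ≈⟨ +-cong (+-cong (×1-homo-* a a′) (-‿cong (×1-homo-* a b′)))
                  (+-cong (×1-homo-* b b′) (-‿cong (×1-homo-* b a′))) ⟩
      (x * x′ - x * y′) + (y * y′ - y * x′)
        ≈⟨ +-congˡ (⁻¹-anti-homo‿- (y * x′) (y * y′)) ⟨
      (x * x′ - x * y′) - (y * x′ - y * y′)
        ≈⟨ +-cong (x[y-z]≈xy-xz x x′ y′) (-‿cong (x[y-z]≈xy-xz y x′ y′)) ⟨
      x * (x′ - y′) - y * (x′ - y′)
        ≈⟨ [y-z]x≈yx-zx (x′ - y′) x y ⟨
      (a ⊖ b) * (a′ ⊖ b′) ∎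
      where
      x = a · 1# ; y = b · 1# ; x′ = a′ · 1# ; y′ = b′ · 1#

  -- Chosen so that the constants 0, 1, 2, … denote 0#, 1#, 1# + 1#, … on the nose.
  ⟦_⟧ : ℕ × ℕ → Carrier
  ⟦ a , zero ⟧ = a · 1#
  ⟦ a , b    ⟧ = a ⊖ b

  private
    ⟦⟧≈⊖ : ∀ a b → ⟦ a , b ⟧ ≈ a ⊖ b
    ⟦⟧≈⊖ a zero    = sym (trans (+-congˡ -0#≈0#) (+-identityʳ _))
    ⟦⟧≈⊖ a (suc b) = refl

    ⟦canonical⟧≈⊖ : ∀ a b → ⟦ canonical (a , b) ⟧ ≈ a ⊖ b
    ⟦canonical⟧≈⊖ zero    b       = ⟦⟧≈⊖ zero b
    ⟦canonical⟧≈⊖ (suc a) zero    = ⟦⟧≈⊖ (suc a) zero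
    ⟦canonical⟧≈⊖ (suc a) (suc b) = trans (⟦canonical⟧≈⊖ a b) (sym (⊖-suc a b))

  homomorphism : ℤ-rawRing -Raw-AlmostCommutative⟶ fromCommutativeRing R
  homomorphism = record
    { ⟦_⟧    = ⟦_⟧
    ; +-homo = λ { (a , b) (a′ , b′) →
        trans (⟦canonical⟧≈⊖ (a ℕ.+ a′) (b ℕ.+ b′))
              (trans (⊖-homo-+ a b a′ b′) (sym (+-cong (⟦⟧≈⊖ a b) (⟦⟧≈⊖ a′ b′)))) }
    ; *-homo = λ { (a , b) (a′ , b′) →
        trans (⟦canonical⟧≈⊖ (a ℕ.* a′ ℕ.+ b ℕ.* b′) (a ℕ.* b′ ℕ.+ b ℕ.* a′))
              (trans (⊖-homo-* a b a′ b′) (sym (*-cong (⟦⟧≈⊖ a b) (⟦⟧≈⊖ a′ b′)))) }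
    ; -‿homo = λ { (a , b) →
        trans (⟦⟧≈⊖ b a) (trans (sym (⁻¹-anti-homo‿- (a · 1#) (b · 1#))) (-‿cong (sym (⟦⟧≈⊖ a b)))) }
    ; 0-homo = refl
    ; 1-homo = refl
    }

  -- Structural equality suffices: the normaliser only produces canonical coefficients.
  _≟-coefficient_ : ∀ p q → Maybe (⟦ p ⟧ ≈ ⟦ q ⟧)
  p ≟-coefficient q with ≡-dec ℕ._≟_ ℕ._≟_ p q
  ... | yes ≡.refl = just refl
  ... | no _       = nothing

  open import Algebra.Solver.Ring ℤ-rawRing (fromCommutativeRing R) homomorphism _≟-coefficient_
    using (Polynomial; con; _:+_; _:*_; _:-_; :-_; _:=_; solve) public

  #_ : ∀ {n} → ℕ → Polynomial n
  # k = con (k , 0)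

module AlternatingSums {c ℓ : Level} (R : CommutativeRing c ℓ) where
  open CommutativeRing R hiding (zero)
  open IntegerCoefficients R
  open import Algebra.Properties.Ring ring using (x[y-z]≈xy-xz)
  open import Algebra.Properties.CommutativeSemigroup *-commutativeSemigroup using (x∙yz≈y∙xz)
  open import Relation.Binary.Reasoning.Setoid setoid

  x-0≈x : ∀ x → x - 0# ≈ x
  x-0≈x = solve 1 (λ x → x :- # 0 := x) refl

  altSum-cong : ∀ {n} {f g : Fin n → Carrier} → (∀ i → f i ≈ g i) → altSum R f ≈ altSum R g
  altSum-cong {zero}  f≈g = refl
  altSum-cong {suc n} f≈g = +-cong (f≈g zero) (-‿cong (altSum-cong (f≈g ∘ suc)))

  altSum-zero : ∀ {n} {f : Fin n → Carrier} → (∀ i → f i ≈ 0#) → altSum R f ≈ 0#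
  altSum-zero {zero}  f≈0 = refl
  altSum-zero {suc n} f≈0 = trans (+-cong (f≈0 zero) (-‿cong (altSum-zero (f≈0 ∘ suc)))) (-‿inverseʳ 0#)

  altSum-linear : ∀ {n} a b (f g : Fin n → Carrier) →
                  altSum R (λ i → a * f i + b * g i) ≈ a * altSum R f + b * altSum R g
  altSum-linear {zero}  a b f g = solve 2 (λ a b → # 0 := a :* # 0 :+ b :* # 0) refl a b
  altSum-linear {suc n} a b f g = begin
    (a * f zero + b * g zero) - altSum R (λ i → a * f (suc i) + b * g (suc i))
      ≈⟨ +-congˡ (-‿cong (altSum-linear a b (f ∘ suc) (g ∘ suc))) ⟩
    (a * f zero + b * g zero) - (a * altSum R (f ∘ suc) + b * altSum R (g ∘ suc))
      ≈⟨ solve 6 (λ a b x y u v → (a :* x :+ b :* y) :- (a :* u :+ b :* v) := a :* (x :- u) :+ b :* (y :- v))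
               refl a b (f zero) (g zero) (altSum R (f ∘ suc)) (altSum R (g ∘ suc)) ⟩
    a * altSum R f + b * altSum R g ∎

  altSum-*ˡ : ∀ {n} a (f : Fin n → Carrier) → altSum R (λ i → a * f i) ≈ a * altSum R f
  altSum-*ˡ {zero}  a f = sym (zeroʳ a)
  altSum-*ˡ {suc n} a f = trans (+-congˡ (-‿cong (altSum-*ˡ a (f ∘ suc)))) (sym (x[y-z]≈xy-xz a _ _))

  altSum-sub : ∀ {n} (f g : Fin n → Carrier) → altSum R (λ i → f i - g i) ≈ altSum R f - altSum R g
  altSum-sub {zero}  f g = sym (-‿inverseʳ 0#)
  altSum-sub {suc n} f g = begin
    (f zero - g zero) - altSum R (λ i → f (suc i) - g (suc i))
      ≈⟨ +-congˡ (-‿cong (altSum-sub (f ∘ suc) (g ∘ suc))) ⟩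
    (f zero - g zero) - (altSum R (f ∘ suc) - altSum R (g ∘ suc))
      ≈⟨ solve 4 (λ x y u v → (x :- y) :- (u :- v) := (x :- u) :- (y :- v)) refl (f zero) (g zero) _ _ ⟩
    altSum R f - altSum R g ∎

  altSum-comm : ∀ {m n} (F : Fin m → Fin n → Carrier) →
                altSum R (λ i → altSum R (F i)) ≈ altSum R (λ k → altSum R (λ i → F i k))
  altSum-comm {zero}  F = sym (altSum-zero {f = λ k → altSum R (λ i → F i k)} (λ _ → refl))
  altSum-comm {suc m} F = begin
    altSum R (F zero) - altSum R (λ i → altSum R (F (suc i)))
      ≈⟨ +-congˡ (-‿cong (altSum-comm (F ∘ suc))) ⟩
    altSum R (F zero) - altSum R (λ k → altSum R (λ i → F (suc i) k))
      ≈⟨ altSum-sub (F zero) (λ k → altSum R (λ i → F (suc i) k)) ⟨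
    altSum R (λ k → altSum R (λ i → F i k)) ∎

  altSum-exchange : ∀ {m n} (a : Fin m → Carrier) (b : Fin n → Carrier) (F : Fin m → Fin n → Carrier) →
    altSum R (λ i → a i * altSum R (λ k → b k * F i k)) ≈ altSum R (λ k → b k * altSum R (λ i → a i * F i k))
  altSum-exchange a b F = begin
    altSum R (λ i → a i * altSum R (λ k → b k * F i k))
      ≈⟨ altSum-cong (λ i → altSum-*ˡ (a i) (λ k → b k * F i k)) ⟨
    altSum R (λ i → altSum R (λ k → a i * (b k * F i k)))
      ≈⟨ altSum-comm (λ i k → a i * (b k * F i k)) ⟩
    altSum R (λ k → altSum R (λ i → a i * (b k * F i k)))
      ≈⟨ altSum-cong (λ k → altSum-cong (λ i → x∙yz≈y∙xz (a i) (b k) (F i k))) ⟩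
    altSum R (λ k → altSum R (λ i → b k * (a i * F i k)))
      ≈⟨ altSum-cong (λ k → altSum-*ˡ (b k) (λ i → a i * F i k)) ⟩
    altSum R (λ k → b k * altSum R (λ i → a i * F i k)) ∎

  altSum-adjacent-cancel : ∀ {n} (f : Fin (suc n) → Carrier) (r : Fin n) →
    (∀ i → i ≢ inject₁ r → i ≢ suc r → f i ≈ 0#) → f (inject₁ r) ≈ f (suc r) → altSum R f ≈ 0#
  altSum-adjacent-cancel f zero    f≈0 f₀≈f₁ = begin
    f zero - (f (suc zero) - altSum R (λ i → f (suc (suc i))))
      ≈⟨ +-congˡ (-‿cong (+-congˡ (-‿cong (altSum-zero (λ i → f≈0 (suc (suc i)) (λ ()) (λ ())))))) ⟩
    f zero - (f (suc zero) - 0#)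
      ≈⟨ +-cong f₀≈f₁ (-‿cong (x-0≈x _)) ⟩
    f (suc zero) - f (suc zero)
      ≈⟨ -‿inverseʳ _ ⟩
    0# ∎
  altSum-adjacent-cancel f (suc r) f≈0 fᵣ≈fᵣ₊₁ =
    trans (+-cong (f≈0 zero (λ ()) (λ ())) (-‿cong (altSum-adjacent-cancel (f ∘ suc) r f∘suc≈0 fᵣ≈fᵣ₊₁)))
          (-‿inverseʳ 0#)
    where
    f∘suc≈0 : ∀ i → i ≢ inject₁ r → i ≢ suc r → f (suc i) ≈ 0#
    f∘suc≈0 i i≢r i≢r+1 = f≈0 (suc i) (i≢r ∘ suc-injective) (i≢r+1 ∘ suc-injective)

module Determinants {c ℓ : Level} (R : CommutativeRing c ℓ) where
  open CommutativeRing R hiding (zero)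
  open IntegerCoefficients R
  open AlternatingSums R
  open import Relation.Binary.Reasoning.Setoid setoid

  Matrix : ℕ → Set c
  Matrix n = Fin n → Fin n → Carrier

  minor : ∀ {n} → Fin (suc n) → Matrix (suc n) → Matrix n
  minor i M j k = M (punchIn i j) (suc k)

  det-cong : ∀ {n} {M N : Matrix n} → (∀ i k → M i k ≈ N i k) → det R M ≈ det R N
  det-cong {zero}  M≈N = refl
  det-cong {suc n} M≈N = altSum-cong (λ i → *-cong (M≈N i zero) (det-cong (λ j k → M≈N (punchIn i j) (suc k))))

  det-linear-row : ∀ {n} (r : Fin n) {M M₁ M₂ : Matrix n} a b →
    (∀ i → i ≢ r → ∀ k → M₁ i k ≈ M i k) →
    (∀ i → i ≢ r → ∀ k → M₂ i k ≈ M i k) →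
    (∀ k → M r k ≈ a * M₁ r k + b * M₂ r k) →
    det R M ≈ a * det R M₁ + b * det R M₂
  det-linear-row {suc n} r {M} {M₁} {M₂} a b M₁≈M M₂≈M Mᵣ≈ =
    trans (altSum-cong term) (altSum-linear a b (term-of M₁) (term-of M₂))
    where
    term-of : Matrix (suc n) → Fin (suc n) → Carrier
    term-of N i = N i zero * det R (minor i N)
    term : ∀ i → term-of M i ≈ a * term-of M₁ i + b * term-of M₂ i
    term i with i ≟ r
    ... | yes ≡.refl = begin
      M i zero * det R (minor i M)
        ≈⟨ *-congʳ (Mᵣ≈ zero) ⟩
      (a * M₁ i zero + b * M₂ i zero) * det R (minor i M)
        ≈⟨ solve 5 (λ a b x y d → (a :* x :+ b :* y) :* d := a :* (x :* d) :+ b :* (y :* d))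
                 refl a b (M₁ i zero) (M₂ i zero) (det R (minor i M)) ⟩
      a * (M₁ i zero * det R (minor i M)) + b * (M₂ i zero * det R (minor i M))
        ≈⟨ +-cong (*-congˡ (*-congˡ (det-cong (λ j k → sym (M₁≈M (punchIn i j) (punchInᵢ≢i i j) (suc k))))))
                  (*-congˡ (*-congˡ (det-cong (λ j k → sym (M₂≈M (punchIn i j) (punchInᵢ≢i i j) (suc k)))))) ⟩
      a * term-of M₁ i + b * term-of M₂ i ∎
    ... | no i≢r = begin
      M i zero * det R (minor i M)
        ≈⟨ *-congˡ minor-linear ⟩
      M i zero * (a * det R (minor i M₁) + b * det R (minor i M₂))
        ≈⟨ solve 5 (λ a b x y z → x :* (a :* y :+ b :* z) := a :* (x :* y) :+ b :* (x :* z))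
                 refl a b (M i zero) (det R (minor i M₁)) (det R (minor i M₂)) ⟩
      a * (M i zero * det R (minor i M₁)) + b * (M i zero * det R (minor i M₂))
        ≈⟨ +-cong (*-congˡ (*-congʳ (sym (M₁≈M i i≢r zero)))) (*-congˡ (*-congʳ (sym (M₂≈M i i≢r zero)))) ⟩
      a * term-of M₁ i + b * term-of M₂ i ∎
      where
      r′ = punchOut i≢r
      ≢r′ : ∀ {j} → j ≢ r′ → punchIn i j ≢ r
      ≢r′ j≢r′ eq = j≢r′ (≡.trans (≡.sym (punchOut-punchIn i)) (punchOut-cong i eq))
      minor-linear : det R (minor i M) ≈ a * det R (minor i M₁) + b * det R (minor i M₂)
      minor-linear = det-linear-row r′ a b
        (λ j j≢r′ k → M₁≈M (punchIn i j) (≢r′ j≢r′) (suc k))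
        (λ j j≢r′ k → M₂≈M (punchIn i j) (≢r′ j≢r′) (suc k))
        (λ k → ≡.subst (λ t → M t (suc k) ≈ a * M₁ t (suc k) + b * M₂ t (suc k))
                       (≡.sym (punchIn-punchOut i≢r)) (Mᵣ≈ (suc k)))

  det-zero-row : ∀ {n} {M : Matrix n} r → (∀ k → M r k ≈ 0#) → det R M ≈ 0#
  det-zero-row {M = M} r Mᵣ≈0 = begin
    det R M
      ≈⟨ det-linear-row r {M₁ = M} {M₂ = M} 0# 0# (λ _ _ _ → refl) (λ _ _ _ → refl)
           (λ k → trans (Mᵣ≈0 k) (solve 1 (λ x → # 0 := # 0 :* x :+ # 0 :* x) refl (M r k))) ⟩
    0# * det R M + 0# * det R M
      ≈⟨ solve 1 (λ x → # 0 :* x :+ # 0 :* x := # 0) refl (det R M) ⟩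
    0# ∎

  det-first-row-diagonal : ∀ {n} (M : Matrix (suc n)) → (∀ k → M zero (suc k) ≈ 0#) →
                           det R M ≈ M zero zero * det R (minor zero M)
  det-first-row-diagonal {zero}  M _        = x-0≈x _
  det-first-row-diagonal {suc n} M row-zero = trans (+-congˡ (-‿cong (altSum-zero other-terms))) (x-0≈x _)
    where
    other-terms : ∀ i → M (suc i) zero * det R (minor (suc i) M) ≈ 0#
    other-terms i = trans (*-congˡ (det-zero-row {M = minor (suc i) M} zero row-zero)) (zeroʳ _)

  adjacent-rows-avoiding : ∀ {n} (i : Fin (suc (suc n))) (r : Fin (suc n)) → i ≢ inject₁ r → i ≢ suc r →
    ∃ λ r′ → punchIn i (inject₁ r′) ≡ inject₁ r × punchIn i (suc r′) ≡ suc r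
  adjacent-rows-avoiding zero          zero    i≢r _     = contradiction ≡.refl i≢r
  adjacent-rows-avoiding zero          (suc r) _   _     = r , ≡.refl , ≡.refl
  adjacent-rows-avoiding (suc zero)    zero    _   i≢r+1 = contradiction ≡.refl i≢r+1
  adjacent-rows-avoiding {suc n} (suc (suc i)) zero _ _  = zero , ≡.refl , ≡.refl
  adjacent-rows-avoiding {suc n} (suc i) (suc r) i≢r i≢r+1
    with r′ , ≡r , ≡r+1 ← adjacent-rows-avoiding i r (i≢r ∘ ≡.cong suc) (i≢r+1 ∘ ≡.cong suc)
    = suc r′ , ≡.cong suc ≡r , ≡.cong suc ≡r+1

  minors-of-equal-adjacent-rows : ∀ {n m} (M : Fin (suc n) → Fin m → Carrier) (r : Fin n) →
    (∀ k → M (inject₁ r) k ≈ M (suc r) k) → ∀ j k → M (punchIn (inject₁ r) j) k ≈ M (punchIn (suc r) j) k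
  minors-of-equal-adjacent-rows M zero    Mᵣ≈Mᵣ₊₁ zero    k = sym (Mᵣ≈Mᵣ₊₁ k)
  minors-of-equal-adjacent-rows M zero    Mᵣ≈Mᵣ₊₁ (suc j) k = refl
  minors-of-equal-adjacent-rows M (suc r) Mᵣ≈Mᵣ₊₁ zero    k = refl
  minors-of-equal-adjacent-rows M (suc r) Mᵣ≈Mᵣ₊₁ (suc j) k =
    minors-of-equal-adjacent-rows (M ∘ suc) r Mᵣ≈Mᵣ₊₁ j k

  det-adjacent-equal-rows : ∀ {n} (M : Matrix (suc n)) (r : Fin n) →
                            (∀ k → M (inject₁ r) k ≈ M (suc r) k) → det R M ≈ 0#
  det-adjacent-equal-rows {suc n} M r Mᵣ≈Mᵣ₊₁ =
    altSum-adjacent-cancel (λ i → M i zero * det R (minor i M)) r other-terms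
      (*-cong (Mᵣ≈Mᵣ₊₁ zero) (det-cong (λ j k → minors-of-equal-adjacent-rows M r Mᵣ≈Mᵣ₊₁ j (suc k))))
    where
    other-terms : ∀ i → i ≢ inject₁ r → i ≢ suc r → M i zero * det R (minor i M) ≈ 0#
    other-terms i i≢r i≢r+1 with r′ , ≡r , ≡r+1 ← adjacent-rows-avoiding i r i≢r i≢r+1 =
      trans (*-congˡ (det-adjacent-equal-rows (minor i M) r′ equal)) (zeroʳ _)
      where
      equal : ∀ k → minor i M (inject₁ r′) k ≈ minor i M (suc r′) k
      equal k rewrite ≡r | ≡r+1 = Mᵣ≈Mᵣ₊₁ (suc k)

  det-first-row-expansion : ∀ {n} (M : Matrix (suc n)) →
    det R M ≈ altSum R (λ k → M zero k * det R (λ j l → M (suc j) (punchIn k l)))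
  det-first-row-expansion {zero}  M = refl
  det-first-row-expansion {suc n} M = begin
    M zero zero * det R (minor zero M) - altSum R (λ i → M (suc i) zero * det R (minor (suc i) M))
      ≈⟨ +-congˡ (-‿cong (altSum-cong (λ i → *-congˡ {M (suc i) zero} (det-first-row-expansion (minor (suc i) M))))) ⟩
    M zero zero * det R (minor zero M) - altSum R (λ i → M (suc i) zero * altSum R (λ k → M zero (suc k) * N i k))
      ≈⟨ +-congˡ (-‿cong (altSum-exchange (λ i → M (suc i) zero) (λ k → M zero (suc k)) N)) ⟩
    M zero zero * det R (minor zero M) - altSum R (λ k → M zero (suc k) * altSum R (λ i → M (suc i) zero * N i k)) ∎
    where
    N : Fin (suc n) → Fin (suc n) → Carrier
    N i k = det R (λ j l → M (suc (punchIn i j)) (suc (punchIn k l)))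

  det-transpose : ∀ {n} (M : Matrix n) → det R (λ j k → M k j) ≈ det R M
  det-transpose {zero}  M = refl
  det-transpose {suc n} M = begin
    det R (λ j k → M k j)
      ≈⟨ altSum-cong (λ i → *-congˡ {M zero i} (det-transpose (λ j k → M (suc j) (punchIn i k)))) ⟩
    altSum R (λ k → M zero k * det R (λ j l → M (suc j) (punchIn k l)))
      ≈⟨ det-first-row-expansion M ⟨
    det R M ∎

module RowOperations {c ℓ : Level} (R : CommutativeRing c ℓ) where
  open CommutativeRing R hiding (zero)
  open IntegerCoefficients R
  open AlternatingSums R
  open Determinants R
  open import Algebra.Properties.Ring ring using (-‿involutive; -0#≈0#)
  open import Relation.Binary.Reasoning.Setoid setoid

  Matrix∞ : Set c
  Matrix∞ = ℕ → ℕ → Carrier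

  leading : (n : ℕ) → Matrix∞ → Matrix n
  leading n f i k = f (toℕ i) (toℕ k)

  det-leading-cong : ∀ n {f g : Matrix∞} → (∀ j → j ℕ.< n → ∀ k → f j k ≈ g j k) →
                     det R (leading n f) ≈ det R (leading n g)
  det-leading-cong n f≈g = det-cong (λ i k → f≈g (toℕ i) (toℕ<n i) (toℕ k))

  setRow : ℕ → (ℕ → Carrier) → Matrix∞ → Matrix∞
  setRow zero    u f zero    = u
  setRow zero    u f (suc j) = f (suc j)
  setRow (suc r) u f zero    = f zero
  setRow (suc r) u f (suc j) = setRow r u (f ∘ suc) j

  setRow-updates : ∀ r u f k → setRow r u f r k ≡ u k
  setRow-updates zero    u f k = ≡.refl
  setRow-updates (suc r) u f k = setRow-updates r u (f ∘ suc) k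

  setRow-minimal : ∀ {r j} u f → j ≢ r → setRow r u f j ≡ f j
  setRow-minimal {zero}  {zero}  u f j≢r = contradiction ≡.refl j≢r
  setRow-minimal {zero}  {suc j} u f _   = ≡.refl
  setRow-minimal {suc r} {zero}  u f _   = ≡.refl
  setRow-minimal {suc r} {suc j} u f j≢r = setRow-minimal u (f ∘ suc) (j≢r ∘ ≡.cong suc)

  det-linear-row∞ : ∀ {n r} → r ℕ.< n → ∀ {f f₁ f₂ : Matrix∞} a b →
    (∀ j → j ≢ r → ∀ k → f₁ j k ≈ f j k) →
    (∀ j → j ≢ r → ∀ k → f₂ j k ≈ f j k) →
    (∀ k → f r k ≈ a * f₁ r k + b * f₂ r k) →
    det R (leading n f) ≈ a * det R (leading n f₁) + b * det R (leading n f₂)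
  det-linear-row∞ r<n {f} {f₁} {f₂} a b f₁≈f f₂≈f fᵣ≈ =
    det-linear-row (fromℕ< r<n) a b
      (λ i i≢r k → f₁≈f (toℕ i) (toℕ≢r i≢r) (toℕ k))
      (λ i i≢r k → f₂≈f (toℕ i) (toℕ≢r i≢r) (toℕ k))
      (λ k → ≡.subst (λ t → f t (toℕ k) ≈ a * f₁ t (toℕ k) + b * f₂ t (toℕ k))
                     (≡.sym (toℕ-fromℕ< r<n)) (fᵣ≈ (toℕ k)))
    where
    toℕ≢r : ∀ {i} → i ≢ fromℕ< r<n → toℕ i ≢ _
    toℕ≢r i≢r eq = i≢r (toℕ-injective (≡.trans eq (≡.sym (toℕ-fromℕ< r<n))))

  det-adjacent-equal-rows∞ : ∀ {n p} {f : Matrix∞} → suc p ℕ.< n → (∀ k → f p k ≈ f (suc p) k) →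
                             det R (leading n f) ≈ 0#
  det-adjacent-equal-rows∞ {suc n} {p} {f} (ℕ.s≤s p<n) fₚ≈fₚ₊₁ =
    det-adjacent-equal-rows (leading (suc n) f) r
      (λ k → ≡.subst₂ (λ s t → f s (toℕ k) ≈ f t (toℕ k))
                      (≡.sym toℕ-r) (≡.sym (≡.cong suc (toℕ-fromℕ< p<n))) (fₚ≈fₚ₊₁ (toℕ k)))
    where
    r = fromℕ< p<n
    toℕ-r : toℕ (inject₁ r) ≡ p
    toℕ-r = ≡.trans (toℕ-inject₁ r) (toℕ-fromℕ< p<n)

  setAdjacentRows : ℕ → (ℕ → Carrier) → (ℕ → Carrier) → Matrix∞ → Matrix∞
  setAdjacentRows p u v f = setRow (suc p) v (setRow p u f)

  swapRows : ℕ → Matrix∞ → Matrix∞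
  swapRows p f = setAdjacentRows p (f (suc p)) (f p) f

  setAdjacentRows-first : ∀ p u v f k → setAdjacentRows p u v f p k ≡ u k
  setAdjacentRows-first p u v f k =
    ≡.trans (≡.cong-app (setRow-minimal v (setRow p u f) (<⇒≢ (n<1+n p))) k) (setRow-updates p u f k)

  setAdjacentRows-second : ∀ p u v f k → setAdjacentRows p u v f (suc p) k ≡ v k
  setAdjacentRows-second p u v f = setRow-updates (suc p) v (setRow p u f)

  setAdjacentRows-other : ∀ {p j} u v f → j ≢ p → j ≢ suc p → setAdjacentRows p u v f j ≡ f j
  setAdjacentRows-other {p} u v f j≢p j≢p+1 = ≡.trans (setRow-minimal v (setRow p u f) j≢p+1) (setRow-minimal u f j≢p)

  det-setAdjacentRows-alternating : ∀ {n p} f u → suc p ℕ.< n → det R (leading n (setAdjacentRows p u u f)) ≈ 0#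
  det-setAdjacentRows-alternating {p = p} f u p+1<n =
    det-adjacent-equal-rows∞ {f = setAdjacentRows p u u f} p+1<n
      (λ k → reflexive (≡.trans (setAdjacentRows-first p u u f k) (≡.sym (setAdjacentRows-second p u u f k))))

  det-setAdjacentRows-linearˡ : ∀ {n p} f a b u₁ u₂ v → p ℕ.< n →
    det R (leading n (setAdjacentRows p (λ k → a * u₁ k + b * u₂ k) v f)) ≈
      a * det R (leading n (setAdjacentRows p u₁ v f)) + b * det R (leading n (setAdjacentRows p u₂ v f))
  det-setAdjacentRows-linearˡ {p = p} f a b u₁ u₂ v p<n = det-linear-row∞ p<n a b (off u₁) (off u₂)
    (λ k → reflexive (≡.trans (first u k)
                              (≡.cong₂ (λ s t → a * s + b * t) (≡.sym (first u₁ k)) (≡.sym (first u₂ k)))))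
    where
    u : ℕ → Carrier
    u k = a * u₁ k + b * u₂ k
    first : ∀ u k → setAdjacentRows p u v f p k ≡ u k
    first u = setAdjacentRows-first p u v f
    off : ∀ u′ j → j ≢ p → ∀ k → setAdjacentRows p u′ v f j k ≈ setAdjacentRows p u v f j k
    off u′ j j≢p k with j ℕ.≟ suc p
    ... | yes ≡.refl = reflexive (≡.trans (setAdjacentRows-second p u′ v f k) (≡.sym (setAdjacentRows-second p u v f k)))
    ... | no j≢p+1   = reflexive (≡.cong-app (≡.trans (setAdjacentRows-other u′ v f j≢p j≢p+1)
                                                      (≡.sym (setAdjacentRows-other u v f j≢p j≢p+1))) k)

  det-setAdjacentRows-linearʳ : ∀ {n p} f a b u v₁ v₂ → suc p ℕ.< n →
    det R (leading n (setAdjacentRows p u (λ k → a * v₁ k + b * v₂ k) f)) ≈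
      a * det R (leading n (setAdjacentRows p u v₁ f)) + b * det R (leading n (setAdjacentRows p u v₂ f))
  det-setAdjacentRows-linearʳ {p = p} f a b u v₁ v₂ p+1<n = det-linear-row∞ p+1<n a b (off v₁) (off v₂)
    (λ k → reflexive (≡.trans (second v k)
                              (≡.cong₂ (λ s t → a * s + b * t) (≡.sym (second v₁ k)) (≡.sym (second v₂ k)))))
    where
    v : ℕ → Carrier
    v k = a * v₁ k + b * v₂ k
    second : ∀ v k → setAdjacentRows p u v f (suc p) k ≡ v k
    second v = setAdjacentRows-second p u v f
    off : ∀ v′ j → j ≢ suc p → ∀ k → setAdjacentRows p u v′ f j k ≈ setAdjacentRows p u v f j k
    off v′ j j≢p+1 k with j ℕ.≟ p
    ... | yes ≡.refl = reflexive (≡.trans (setAdjacentRows-first p u v′ f k) (≡.sym (setAdjacentRows-first p u v f k)))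
    ... | no j≢p     = reflexive (≡.cong-app (≡.trans (setAdjacentRows-other u v′ f j≢p j≢p+1)
                                                      (≡.sym (setAdjacentRows-other u v f j≢p j≢p+1))) k)

  -- Expand B(f₀ + f₁, f₀ + f₁) = 0 by bilinearity, where B(u, v) is the determinant with
  -- rows p, p + 1 replaced by u, v; the terms B(u, u) vanish.
  det-swapRows : ∀ {n p} (f : Matrix∞) → suc p ℕ.< n → det R (leading n (swapRows p f)) ≈ - det R (leading n f)
  det-swapRows {n} {p} f p+1<n = begin
    B f₁ f₀
      ≈⟨ cancel (B f₀ f₀) (B f₀ f₁) (B f₁ f₀) (B f₁ f₁) ⟩
    (1# * (1# * B f₀ f₀ + 1# * B f₀ f₁) + 1# * (1# * B f₁ f₀ + 1# * B f₁ f₁)) - B f₀ f₁ - B f₀ f₀ - B f₁ f₁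
      ≈⟨ +-cong (+-cong (+-cong expand (-‿cong unswapped)) (-‿cong (alternating f₀))) (-‿cong (alternating f₁)) ⟩
    B s s - det R (leading n f) - 0# - 0#
      ≈⟨ +-congʳ (+-congʳ (+-congʳ (alternating s))) ⟩
    0# - det R (leading n f) - 0# - 0#
      ≈⟨ solve 1 (λ d → # 0 :- d :- # 0 :- # 0 := :- d) refl (det R (leading n f)) ⟩
    - det R (leading n f) ∎
    where
    f₀ f₁ s : ℕ → Carrier
    f₀ = f p
    f₁ = f (suc p)
    s k = 1# * f₀ k + 1# * f₁ k
    B : (ℕ → Carrier) → (ℕ → Carrier) → Carrier
    B u v = det R (leading n (setAdjacentRows p u v f))
    alternating : ∀ u → B u u ≈ 0#
    alternating u = det-setAdjacentRows-alternating f u p+1<n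
    expand : 1# * (1# * B f₀ f₀ + 1# * B f₀ f₁) + 1# * (1# * B f₁ f₀ + 1# * B f₁ f₁) ≈ B s s
    expand = sym (trans (det-setAdjacentRows-linearˡ f 1# 1# f₀ f₁ s (<-trans (n<1+n p) p+1<n))
                        (+-cong (*-congˡ (det-setAdjacentRows-linearʳ f 1# 1# f₀ f₀ f₁ p+1<n))
                                (*-congˡ (det-setAdjacentRows-linearʳ f 1# 1# f₁ f₀ f₁ p+1<n))))
    unswapped : B f₀ f₁ ≈ det R (leading n f)
    unswapped = det-leading-cong n (λ j _ k → reflexive (rows j k))
      where
      rows : ∀ j k → setAdjacentRows p f₀ f₁ f j k ≡ f j k
      rows j k with j ℕ.≟ p | j ℕ.≟ suc p
      ... | yes ≡.refl | _          = setAdjacentRows-first p f₀ f₁ f k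
      ... | no _       | yes ≡.refl = setAdjacentRows-second p f₀ f₁ f k
      ... | no j≢p     | no j≢p+1   = ≡.cong-app (setAdjacentRows-other f₀ f₁ f j≢p j≢p+1) k
    cancel : ∀ a b c d → c ≈ (1# * (1# * a + 1# * b) + 1# * (1# * c + 1# * d)) - b - a - d
    cancel = solve 4 (λ a b c d → c := (# 1 :* (# 1 :* a :+ # 1 :* b) :+ # 1 :* (# 1 :* c :+ # 1 :* d)) :- b :- a :- d) refl

  det-equal-rows∞ : ∀ {n i} j {f : Matrix∞} → i ℕ.< j → j ℕ.< n → (∀ k → f i k ≈ f j k) →
                    det R (leading n f) ≈ 0#
  det-equal-rows∞ {n} {i} (suc j) {f} i<j+1 j+1<n fᵢ≈fⱼ₊₁ with m<1+n⇒m<n∨m≡n i<j+1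
  ... | inj₂ ≡.refl = det-adjacent-equal-rows∞ j+1<n fᵢ≈fⱼ₊₁
  ... | inj₁ i<j    = begin
    det R (leading n f)                  ≈⟨ -‿involutive _ ⟨
    - - det R (leading n f)              ≈⟨ -‿cong (det-swapRows f j+1<n) ⟨
    - det R (leading n (swapRows j f))   ≈⟨ -‿cong (det-equal-rows∞ j i<j (<-trans (n<1+n j) j+1<n) swapped-equal) ⟩
    - 0#                                 ≈⟨ -0#≈0# ⟩
    0#                                   ∎
    where
    swapped-equal : ∀ k → swapRows j f i k ≈ swapRows j f j k
    swapped-equal k = begin
      swapRows j f i k
        ≡⟨ ≡.cong-app (setAdjacentRows-other (f (suc j)) (f j) f (<⇒≢ i<j) (<⇒≢ (m<n⇒m<1+n i<j))) k ⟩
      f i k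
        ≈⟨ fᵢ≈fⱼ₊₁ k ⟩
      f (suc j) k
        ≡⟨ setAdjacentRows-first j (f (suc j)) (f j) f k ⟨
      swapRows j f j k ∎

  det-add-earlier-row : ∀ {n r s} {f g : Matrix∞} a → s ℕ.< r →
    (∀ j → j ≢ r → ∀ k → g j k ≈ f j k) → (∀ k → g r k ≈ f r k + a * f s k) →
    det R (leading n g) ≈ det R (leading n f)
  det-add-earlier-row {n} {r} {s} {f} {g} a s<r g≈f gᵣ≈ with r <? n
  ... | no r≮n  = det-leading-cong n (λ j j<n → g≈f j (<⇒≢ (<-≤-trans j<n (≮⇒≥ r≮n))))
  ... | yes r<n = begin
    det R (leading n g)                                    ≈⟨ det-linear-row∞ r<n 1# a f≈g fₛ≈g gᵣ≈′ ⟩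
    1# * det R (leading n f) + a * det R (leading n fₛ)   ≈⟨ +-cong (*-identityˡ _) (*-congˡ fₛ-singular) ⟩
    det R (leading n f) + a * 0#                           ≈⟨ solve 2 (λ d a → d :+ a :* # 0 := d) refl _ a ⟩
    det R (leading n f)                                    ∎
    where
    fₛ : Matrix∞
    fₛ = setRow r (f s) f
    f≈g : ∀ j → j ≢ r → ∀ k → f j k ≈ g j k
    f≈g j j≢r k = sym (g≈f j j≢r k)
    fₛ≈g : ∀ j → j ≢ r → ∀ k → fₛ j k ≈ g j k
    fₛ≈g j j≢r k = trans (reflexive (≡.cong-app (setRow-minimal (f s) f j≢r) k)) (f≈g j j≢r k)
    gᵣ≈′ : ∀ k → g r k ≈ 1# * f r k + a * fₛ r k
    gᵣ≈′ k = trans (gᵣ≈ k) (+-cong (sym (*-identityˡ _)) (*-congˡ (reflexive (≡.sym (setRow-updates r (f s) f k)))))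
    fₛ-singular : det R (leading n fₛ) ≈ 0#
    fₛ-singular = det-equal-rows∞ r {fₛ} s<r r<n
      (λ k → reflexive (≡.trans (≡.cong-app (setRow-minimal (f s) f (<⇒≢ s<r)) k) (≡.sym (setRow-updates r (f s) f k))))

  shift : Matrix∞ → Matrix∞
  shift f j k = f (suc j) (suc k)

  det-expand-sparse-border : ∀ n (f : Matrix∞) →
    (∀ j → f (suc (suc j)) 0 ≈ 0#) → (∀ k → f 0 (suc (suc k)) ≈ 0#) →
    det R (leading (suc (suc n)) f) ≈
      f 0 0 * det R (leading (suc n) (shift f)) - f 1 0 * (f 0 1 * det R (leading n (shift (shift f))))
  det-expand-sparse-border n f column-sparse row-sparse = begin
    term zero - (term (suc zero) - altSum R (λ i → term (suc (suc i))))
      ≈⟨ +-congˡ (-‿cong (+-cong (*-congˡ second-minor)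
                                 (-‿cong (altSum-zero {f = λ i → term (suc (suc i))} lower-terms)))) ⟩
    term zero - (f 1 0 * (f 0 1 * det R (leading n (shift (shift f)))) - 0#)
      ≈⟨ +-congˡ (-‿cong (x-0≈x _)) ⟩
    f 0 0 * det R (leading (suc n) (shift f)) - f 1 0 * (f 0 1 * det R (leading n (shift (shift f)))) ∎
    where
    term : Fin (suc (suc n)) → Carrier
    term i = f (toℕ i) 0 * det R (minor i (leading (suc (suc n)) f))
    lower-terms : ∀ i → term (suc (suc i)) ≈ 0#
    lower-terms i = trans (*-congʳ (column-sparse (toℕ i))) (zeroˡ _)
    second-minor : det R (minor (suc zero) (leading (suc (suc n)) f)) ≈ f 0 1 * det R (leading n (shift (shift f)))
    second-minor = det-first-row-diagonal (minor (suc zero) (leading (suc (suc n)) f)) (λ k → row-sparse (toℕ k))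

module BandReduction {c ℓ : Level} (R : CommutativeRing c ℓ) (a b : CommutativeRing.Carrier R) where
  open CommutativeRing R hiding (zero)
  open IntegerCoefficients R
  open RowOperations R
  open import Relation.Binary.Reasoning.Setoid setoid

  band : Matrix∞ → Matrix∞
  band f zero          k = f zero k
  band f (suc zero)    k = f (suc zero) k
  band f (suc (suc j)) k = f (suc (suc j)) k + a * f (suc j) k + b * f j k

  bandFrom : ℕ → Matrix∞ → Matrix∞
  bandFrom t f j with j <? t
  ... | yes _ = f j
  ... | no  _ = band f j

  bandFrom-below : ∀ t j f → j ℕ.< t → bandFrom t f j ≡ f j
  bandFrom-below t j f j<t with j <? t
  ... | yes _  = ≡.refl
  ... | no j≮t = contradiction j<t j≮t

  bandFrom-above : ∀ t j f → ¬ j ℕ.< t → bandFrom t f j ≡ band f j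
  bandFrom-above t j f j≮t with j <? t
  ... | yes j<t = contradiction j<t j≮t
  ... | no _    = ≡.refl

  bandFrom-suc : ∀ t j f → j ≢ t → bandFrom t f j ≡ bandFrom (suc t) f j
  bandFrom-suc t j f j≢t with j <? t
  ... | yes j<t = ≡.sym (bandFrom-below (suc t) j f (m<n⇒m<1+n j<t))
  ... | no j≮t  = ≡.sym (bandFrom-above (suc t) j f (λ j<t+1 → [ j≮t , j≢t ]′ (m<1+n⇒m<n∨m≡n j<t+1)))

  bandFrom-suc-at-fixed-row : ∀ t f → (∀ k → band f t k ≡ f t k) →
                              ∀ j k → bandFrom t f j k ≡ bandFrom (suc t) f j k
  bandFrom-suc-at-fixed-row t f fixed j k with j ℕ.≟ t
  ... | yes ≡.refl = ≡.trans (≡.cong-app (bandFrom-above t t f (<-irrefl ≡.refl)) k)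
                             (≡.trans (fixed k) (≡.sym (≡.cong-app (bandFrom-below (suc t) t f (n<1+n t)) k)))
  ... | no j≢t     = ≡.cong-app (bandFrom-suc t j f j≢t) k

  det-bandFrom-suc : ∀ {n} t f → det R (leading n (bandFrom t f)) ≈ det R (leading n (bandFrom (suc t) f))
  det-bandFrom-suc {n} zero       f =
    det-leading-cong n (λ j _ k → reflexive (bandFrom-suc-at-fixed-row 0 f (λ _ → ≡.refl) j k))
  det-bandFrom-suc {n} (suc zero) f =
    det-leading-cong n (λ j _ k → reflexive (bandFrom-suc-at-fixed-row 1 f (λ _ → ≡.refl) j k))
  det-bandFrom-suc {n} (suc (suc s)) f = begin
    det R (leading n (bandFrom t f))   ≈⟨ det-add-earlier-row {n} b s<t off-t on-t ⟩
    det R (leading n g₁)               ≈⟨ det-add-earlier-row {n} a (n<1+n (suc s))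
                                            (λ j j≢t k → reflexive (≡.cong-app (setRow-minimal u g j≢t) k))
                                            (λ k → reflexive (setRow-updates t u g k)) ⟩
    det R (leading n g)                ∎
    where
    t = suc (suc s)
    s<t : s ℕ.< t
    s<t = m<n⇒m<1+n (n<1+n s)
    g g₁ : Matrix∞
    g = bandFrom (suc t) f
    u : ℕ → Carrier
    u k = g t k + a * g (suc s) k
    g₁ = setRow t u g
    off-t : ∀ j → j ≢ t → ∀ k → bandFrom t f j k ≈ g₁ j k
    off-t j j≢t k = reflexive (≡.cong-app (≡.trans (bandFrom-suc t j f j≢t) (≡.sym (setRow-minimal u g j≢t))) k)
    on-t : ∀ k → bandFrom t f t k ≈ g₁ t k + b * g₁ s k
    on-t k = begin
      bandFrom t f t k                      ≡⟨ ≡.cong-app (bandFrom-above t t f (<-irrefl ≡.refl)) k ⟩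
      f t k + a * f (suc s) k + b * f s k   ≡⟨ ≡.cong₂ (λ x y → x + a * y + b * f s k) (below t (n<1+n t))
                                                       (below (suc s) (m<n⇒m<1+n (n<1+n (suc s)))) ⟨
      u k + b * f s k                       ≡⟨ ≡.cong (λ x → u k + b * x)
                                                      (≡.trans (≡.cong-app (setRow-minimal u g (<⇒≢ s<t)) k)
                                                               (below s (m<n⇒m<1+n s<t))) ⟨
      u k + b * g₁ s k                      ≡⟨ ≡.cong (λ x → x + b * g₁ s k) (setRow-updates t u g k) ⟨
      g₁ t k + b * g₁ s k                   ∎
      where
      below : ∀ j → j ℕ.< suc t → g j k ≡ f j k
      below j j<t+1 = ≡.cong-app (bandFrom-below (suc t) j f j<t+1) k

  det-band : ∀ n f → det R (leading n (band f)) ≈ det R (leading n f)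
  det-band n f = begin
    det R (leading n (band f))
      ≈⟨ det-leading-cong n (λ j _ k → reflexive (≡.cong-app (≡.sym (bandFrom-above 0 j f (λ ()))) k)) ⟩
    det R (leading n (bandFrom 0 f))
      ≈⟨ iterate n ⟩
    det R (leading n (bandFrom n f))
      ≈⟨ det-leading-cong n (λ j j<n k → reflexive (≡.cong-app (bandFrom-below n j f j<n) k)) ⟩
    det R (leading n f) ∎
    where
    iterate : ∀ m → det R (leading n (bandFrom 0 f)) ≈ det R (leading n (bandFrom m f))
    iterate zero    = refl
    iterate (suc m) = trans (iterate m) (det-bandFrom-suc {n} m f)

  transpose : Matrix∞ → Matrix∞
  transpose f j k = f k j

  band-transpose-band-symmetric : ∀ {f} → (∀ j k → f j k ≈ f k j) →
                                  ∀ j k → band (transpose (band f)) j k ≈ band (transpose (band f)) k j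
  band-transpose-band-symmetric {f} f-sym = P-sym
    where
    bandᵀ : ∀ i k → band f (suc (suc k)) i ≈ f i (suc (suc k)) + a * f i (suc k) + b * f i k
    bandᵀ i k = +-cong (+-cong (f-sym _ _) (*-congˡ (f-sym _ _))) (*-congˡ (f-sym _ _))
    regroup : ∀ x₀₀ x₀₁ x₀₂ x₁₀ x₁₁ x₁₂ x₂₀ x₂₁ x₂₂ →
      (x₀₀ + a * x₀₁ + b * x₀₂) + a * (x₁₀ + a * x₁₁ + b * x₁₂) + b * (x₂₀ + a * x₂₁ + b * x₂₂) ≈
      (x₀₀ + a * x₁₀ + b * x₂₀) + a * (x₀₁ + a * x₁₁ + b * x₂₁) + b * (x₀₂ + a * x₁₂ + b * x₂₂)
    regroup = solve 11 (λ a b x₀₀ x₀₁ x₀₂ x₁₀ x₁₁ x₁₂ x₂₀ x₂₁ x₂₂ →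
        (x₀₀ :+ a :* x₀₁ :+ b :* x₀₂) :+ a :* (x₁₀ :+ a :* x₁₁ :+ b :* x₁₂)
          :+ b :* (x₂₀ :+ a :* x₂₁ :+ b :* x₂₂)
        := (x₀₀ :+ a :* x₁₀ :+ b :* x₂₀) :+ a :* (x₀₁ :+ a :* x₁₁ :+ b :* x₂₁)
          :+ b :* (x₀₂ :+ a :* x₁₂ :+ b :* x₂₂))
      refl a b
    P-sym : ∀ j k → band (transpose (band f)) j k ≈ band (transpose (band f)) k j
    P-sym zero          zero          = refl
    P-sym zero          (suc zero)    = f-sym 1 0
    P-sym (suc zero)    zero          = f-sym 0 1
    P-sym (suc zero)    (suc zero)    = refl
    P-sym zero          (suc (suc k)) = bandᵀ 0 k
    P-sym (suc zero)    (suc (suc k)) = bandᵀ 1 k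
    P-sym (suc (suc j)) zero          = sym (bandᵀ 0 j)
    P-sym (suc (suc j)) (suc zero)    = sym (bandᵀ 1 j)
    P-sym (suc (suc j)) (suc (suc k)) =
      trans (+-cong (+-cong (bandᵀ (suc (suc j)) k) (*-congˡ (bandᵀ (suc j) k))) (*-congˡ (bandᵀ j k)))
            (regroup _ _ _ _ _ _ _ _ _)

module Tridiagonal {c ℓ : Level} (R : CommutativeRing c ℓ) where
  open CommutativeRing R hiding (zero)
  open RowOperations R
  open import Relation.Binary.Reasoning.Setoid setoid

  tridiagonal : (ℕ → Carrier) → (ℕ → Carrier) → Matrix∞
  tridiagonal d e zero       zero       = d zero
  tridiagonal d e zero       (suc zero) = e zero
  tridiagonal d e (suc j)    (suc k)    = tridiagonal (d ∘ suc) (e ∘ suc) j k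
  tridiagonal d e (suc zero) zero       = e zero
  tridiagonal d e _          _          = 0#

  tridiagonal-symmetric : ∀ d e j k → tridiagonal d e j k ≡ tridiagonal d e k j
  tridiagonal-symmetric d e zero          zero          = ≡.refl
  tridiagonal-symmetric d e zero          (suc zero)    = ≡.refl
  tridiagonal-symmetric d e zero          (suc (suc k)) = ≡.refl
  tridiagonal-symmetric d e (suc zero)    zero          = ≡.refl
  tridiagonal-symmetric d e (suc (suc j)) zero          = ≡.refl
  tridiagonal-symmetric d e (suc j)       (suc k)       = tridiagonal-symmetric (d ∘ suc) (e ∘ suc) j k

  det-tridiagonal : ∀ n d e → det R (leading (suc (suc n)) (tridiagonal d e)) ≈
    d 0 * det R (leading (suc n) (tridiagonal (d ∘ suc) (e ∘ suc)))
      - e 0 * (e 0 * det R (leading n (tridiagonal (λ i → d (suc (suc i))) (λ i → e (suc (suc i))))))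
  det-tridiagonal n d e = det-expand-sparse-border n (tridiagonal d e) (λ _ → refl) (λ _ → refl)

  det-tridiagonal-constant : ∀ x z {y} → z * z ≈ y → ∀ m →
    det R (leading m (tridiagonal (λ _ → x) (λ _ → z))) ≈ lucasU R x y (suc m)
  det-tridiagonal-constant x z     z²≈y zero          = refl
  det-tridiagonal-constant x z {y} z²≈y (suc zero)    = +-congˡ (-‿cong (sym (zeroʳ y)))
  det-tridiagonal-constant x z {y} z²≈y (suc (suc m)) = begin
    det R (leading (suc (suc m)) M)
      ≈⟨ det-tridiagonal m (λ _ → x) (λ _ → z) ⟩
    x * det R (leading (suc m) M) - z * (z * det R (leading m M))
      ≈⟨ +-cong (*-congˡ (det-tridiagonal-constant x z z²≈y (suc m)))
                (-‿cong (trans (sym (*-assoc z z _)) (*-cong z²≈y (det-tridiagonal-constant x z z²≈y m)))) ⟩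
    lucasU R x y (suc (suc (suc m))) ∎
    where
    M : Matrix∞
    M = tridiagonal (λ _ → x) (λ _ → z)

module LucasToeplitz {c ℓ : Level} (R : CommutativeRing c ℓ) where
  open CommutativeRing R hiding (zero)
  open IntegerCoefficients R
  open RowOperations R
  open Tridiagonal R
  open import Relation.Binary.Reasoning.Setoid setoid

  module Reduction (A B ε : Carrier) (ε≈±1 : ε ≈ 1# ⊎ ε ≈ - 1#) (w : ℤ → Carrier)
           (w₋₁≈ε : w -[1+ 0 ] ≈ ε) (w₀≈1 : w (+ 0) ≈ 1#)
           (recurrence : ∀ m → w (+ suc m) ≈ A * w (+ m) - B * w (Data.Integer._-_ (+ m) (+ 1))) where
    open BandReduction R (- A) B

    v : ℕ → Carrier
    v m = w (+ m)

    T Q P : Matrix∞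
    T j k = v ∣ j - k ∣
    Q = band T
    P = band (transpose Q)

    γ x y : Carrier
    γ = v 1 + (- A) * v 0 + B * v 1
    x = 1# - (A - ε * B) * (A - ε * B)
    y = (B * B) * ((1# + B - ε * A) * (1# + B - ε * A))

    v-recurrence : ∀ m → v (suc (suc m)) + (- A) * v (suc m) + B * v m ≈ 0#
    v-recurrence m = begin
      v (suc (suc m)) + (- A) * v (suc m) + B * v m
        ≈⟨ +-congʳ (+-congʳ (recurrence (suc m))) ⟩
      (A * v (suc m) - B * v m) + (- A) * v (suc m) + B * v m
        ≈⟨ solve 4 (λ a b s t → (a :* s :- b :* t) :+ (:- a) :* s :+ b :* t := # 0) refl A B (v (suc m)) (v m) ⟩
      0# ∎

    v₁≈ : v 1 ≈ A - ε * B
    v₁≈ = begin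
      v 1                        ≈⟨ recurrence 0 ⟩
      A * v 0 - B * w -[1+ 0 ]   ≈⟨ +-cong (*-congˡ w₀≈1) (-‿cong (*-congˡ w₋₁≈ε)) ⟩
      A * 1# - B * ε             ≈⟨ solve 3 (λ a b e → a :* # 1 :- b :* e := a :- e :* b) refl A B ε ⟩
      A - ε * B                  ∎

    ε²≈1 : ε * ε ≈ 1#
    ε²≈1 = [ (λ ε≈1 → trans (*-cong ε≈1 ε≈1) (*-identityˡ 1#))
           , (λ ε≈-1 → trans (*-cong ε≈-1 ε≈-1) (solve 0 (:- # 1 :* :- # 1 := # 1) refl)) ]′ ε≈±1

    modulo-ε² : ∀ {p q} r → p ≈ q + r * (ε * ε - 1#) → p ≈ q
    modulo-ε² {p} {q} r p≈ = begin
      p                       ≈⟨ p≈ ⟩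
      q + r * (ε * ε - 1#)    ≈⟨ +-congˡ (*-congˡ (+-congʳ ε²≈1)) ⟩
      q + r * (1# - 1#)       ≈⟨ solve 2 (λ q r → q :+ r :* (# 1 :- # 1) := q) refl q r ⟩
      q                       ∎

    1-v₁²≈x : 1# - v 1 * v 1 ≈ x
    1-v₁²≈x = +-congˡ (-‿cong (*-cong v₁≈ v₁≈))

    γ≈ : γ ≈ (A - ε * B) + (- A) * 1# + B * (A - ε * B)
    γ≈ = +-cong (+-cong v₁≈ (*-congˡ w₀≈1)) (*-congˡ v₁≈)

    γ²≈y : γ * γ ≈ y
    γ²≈y = modulo-ε² (B * B * ((1# + B) * (1# + B) - A * A)) (begin
      γ * γ
        ≈⟨ *-cong γ≈ γ≈ ⟩
      ((A - ε * B) + (- A) * 1# + B * (A - ε * B)) * ((A - ε * B) + (- A) * 1# + B * (A - ε * B))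
        ≈⟨ solve 3 (λ a b e → let s = a :- e :* b in
                     (s :+ (:- a) :* # 1 :+ b :* s) :* (s :+ (:- a) :* # 1 :+ b :* s)
                     := (b :* b) :* ((# 1 :+ b :- e :* a) :* (# 1 :+ b :- e :* a))
                        :+ b :* b :* ((# 1 :+ b) :* (# 1 :+ b) :- a :* a) :* (e :* e :- # 1))
                 refl A B ε ⟩
      y + B * B * ((1# + B) * (1# + B) - A * A) * (ε * ε - 1#) ∎)

    T-column₀ : ∀ j → T j 0 ≡ v j
    T-column₀ zero    = ≡.refl
    T-column₀ (suc j) = ≡.refl

    T-symmetric : ∀ j k → T j k ≈ T k j
    T-symmetric j k = reflexive (≡.cong v (∣-∣-comm j k))

    Q-lower : ∀ j k → k ℕ.≤ j → Q (suc (suc j)) k ≈ 0#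
    Q-lower j       zero    _           = begin
      Q (suc (suc j)) 0
        ≡⟨ ≡.cong (λ t → v (suc (suc j)) + (- A) * v (suc j) + B * t) (T-column₀ j) ⟩
      v (suc (suc j)) + (- A) * v (suc j) + B * v j
        ≈⟨ v-recurrence j ⟩
      0# ∎
    Q-lower (suc j) (suc k) (ℕ.s≤s k≤j) = Q-lower j k k≤j

    Q-subdiagonal : ∀ j → Q (suc (suc j)) (suc j) ≡ γ
    Q-subdiagonal zero    = ≡.refl
    Q-subdiagonal (suc j) = Q-subdiagonal j

    P₂₂≈x : P 2 2 ≈ x
    P₂₂≈x = modulo-ε² (B * B) (begin
      (v 0 + (- A) * v 1 + B * v 2) + (- A) * γ + B * Q 2 0
        ≈⟨ +-cong (+-cong (+-cong (+-cong w₀≈1 (*-congˡ v₁≈)) (*-congˡ v₂≈)) (*-congˡ γ≈))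
                  (*-congˡ (Q-lower 0 0 ℕ.z≤n)) ⟩
      (1# + (- A) * (A - ε * B) + B * (A * (A - ε * B) - B * 1#)) + (- A) * ((A - ε * B) + (- A) * 1# + B * (A - ε * B))
        + B * 0#
        ≈⟨ solve 3 (λ a b e → let s = a :- e :* b in
                     (# 1 :+ (:- a) :* s :+ b :* (a :* s :- b :* # 1)) :+ (:- a) :* (s :+ (:- a) :* # 1 :+ b :* s) :+ b :* # 0
                     := (# 1 :- s :* s) :+ (b :* b) :* (e :* e :- # 1))
                 refl A B ε ⟩
      x + B * B * (ε * ε - 1#) ∎)
      where
      v₂≈ : v 2 ≈ A * (A - ε * B) - B * 1#
      v₂≈ = trans (recurrence 1) (+-cong (*-congˡ v₁≈) (-‿cong (*-congˡ w₀≈1)))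

    diagonal offDiagonal : ℕ → Carrier
    diagonal zero          = 1#
    diagonal (suc zero)    = 1#
    diagonal (suc (suc _)) = x
    offDiagonal zero    = v 1
    offDiagonal (suc _) = γ

    drop-band-terms : ∀ p q r → q ≈ 0# → r ≈ 0# → p + (- A) * q + B * r ≈ p
    drop-band-terms p q r q≈0 r≈0 = begin
      p + (- A) * q + B * r     ≈⟨ +-cong (+-congˡ (*-congˡ q≈0)) (*-congˡ r≈0) ⟩
      p + (- A) * 0# + B * 0#   ≈⟨ solve 3 (λ p a b → p :+ (:- a) :* # 0 :+ b :* # 0 := p) refl p A B ⟩
      p                         ∎

    -- P (3 + j) (3 + k) and P (2 + j) (2 + k) agree by definition, so only the first three
    -- rows need work.
    P-upper : ∀ {j k} → j ℕ.≤ k → P j k ≈ tridiagonal diagonal offDiagonal j k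
    P-upper {0} {0}           ℕ.z≤n = w₀≈1
    P-upper {0} {1}           ℕ.z≤n = refl
    P-upper {0} {suc (suc k)} ℕ.z≤n = Q-lower k 0 ℕ.z≤n
    P-upper {1} {1}                 (ℕ.s≤s ℕ.z≤n) = w₀≈1
    P-upper {1} {2}                 (ℕ.s≤s ℕ.z≤n) = refl
    P-upper {1} {suc (suc (suc k))} (ℕ.s≤s ℕ.z≤n) = Q-lower (suc k) 1 (ℕ.s≤s ℕ.z≤n)
    P-upper {2} {2}                       (ℕ.s≤s (ℕ.s≤s ℕ.z≤n)) = P₂₂≈x
    P-upper {2} {3}                       (ℕ.s≤s (ℕ.s≤s ℕ.z≤n)) =
      trans (drop-band-terms (Q 3 2) _ _ (Q-lower 1 1 (ℕ.s≤s ℕ.z≤n)) (Q-lower 1 0 ℕ.z≤n)) (reflexive (Q-subdiagonal 1))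
    P-upper {2} {suc (suc (suc (suc k)))} (ℕ.s≤s (ℕ.s≤s ℕ.z≤n)) =
      trans (drop-band-terms _ _ _ (Q-lower (suc (suc k)) 1 (ℕ.s≤s ℕ.z≤n)) (Q-lower (suc (suc k)) 0 ℕ.z≤n))
            (Q-lower (suc (suc k)) 2 (ℕ.s≤s (ℕ.s≤s ℕ.z≤n)))
    P-upper {suc (suc (suc j))} {suc (suc (suc k))} (ℕ.s≤s (ℕ.s≤s (ℕ.s≤s j≤k))) = P-upper (ℕ.s≤s (ℕ.s≤s j≤k))

    P≈tridiagonal : ∀ j k → P j k ≈ tridiagonal diagonal offDiagonal j k
    P≈tridiagonal j k with ≤-total j k
    ... | inj₁ j≤k = P-upper j≤k
    ... | inj₂ k≤j = begin
      P j k                                  ≈⟨ band-transpose-band-symmetric T-symmetric j k ⟩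
      P k j                                  ≈⟨ P-upper k≤j ⟩
      tridiagonal diagonal offDiagonal k j   ≡⟨ tridiagonal-symmetric diagonal offDiagonal k j ⟩
      tridiagonal diagonal offDiagonal j k   ∎

    det-tridiagonal≈lucasU : ∀ m → det R (leading (suc m) (tridiagonal diagonal offDiagonal)) ≈ lucasU R x y (suc m)
    det-tridiagonal≈lucasU zero          = solve 0 (# 1 :* # 1 :- # 0 := # 1) refl
    det-tridiagonal≈lucasU (suc zero)    = begin
      det R (leading 2 (tridiagonal diagonal offDiagonal))
        ≈⟨ det-tridiagonal 0 diagonal offDiagonal ⟩
      1# * (1# * 1# - 0#) - v 1 * (v 1 * 1#)
        ≈⟨ solve 1 (λ t → # 1 :* (# 1 :* # 1 :- # 0) :- t :* (t :* # 1) := # 1 :- t :* t) refl (v 1) ⟩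
      1# - v 1 * v 1
        ≈⟨ 1-v₁²≈x ⟩
      x
        ≈⟨ solve 2 (λ x y → x := x :* # 1 :- y :* # 0) refl x y ⟩
      lucasU R x y 2 ∎
    det-tridiagonal≈lucasU (suc (suc m)) = begin
      det R (leading (3 ℕ.+ m) (tridiagonal diagonal offDiagonal))
        ≈⟨ det-tridiagonal (suc m) diagonal offDiagonal ⟩
      1# * det R (leading (2 ℕ.+ m) (tridiagonal (diagonal ∘ suc) (offDiagonal ∘ suc))) - v 1 * (v 1 * U (suc m))
        ≈⟨ +-congʳ (*-congˡ (det-tridiagonal m (diagonal ∘ suc) (offDiagonal ∘ suc))) ⟩
      1# * (1# * U (suc m) - γ * (γ * U m)) - v 1 * (v 1 * U (suc m))
        ≈⟨ solve 4 (λ u₁ u₀ g t → # 1 :* (# 1 :* u₁ :- g :* (g :* u₀)) :- t :* (t :* u₁)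
                                  := (# 1 :- t :* t) :* u₁ :- (g :* g) :* u₀)
                 refl (U (suc m)) (U m) γ (v 1) ⟩
      (1# - v 1 * v 1) * U (suc m) - (γ * γ) * U m
        ≈⟨ +-cong (*-cong 1-v₁²≈x (det-tridiagonal-constant x γ γ²≈y (suc m)))
                  (-‿cong (*-cong γ²≈y (det-tridiagonal-constant x γ γ²≈y m))) ⟩
      lucasU R x y (3 ℕ.+ m) ∎
      where
      U : ℕ → Carrier
      U k = det R (leading k (tridiagonal (λ _ → x) (λ _ → γ)))

corollary1p7 : {c ℓ : Level} (R : CommutativeRing c ℓ) →
    let open CommutativeRing R in
    (A B ε : Carrier) → (ε ≈ 1# ⊎ ε ≈ - 1#) →
    (w : ℤ → Carrier) →
    w -[1+ 0 ] ≈ ε →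
    w (+ 0) ≈ 1# →
    (∀ (m : ℕ) → w (+ suc m) ≈ A * w (+ m) - B * w (Data.Integer._-_ (+ m) (+ 1))) →
    ∀ (n : ℕ) → 1 ≤ n →
    det R {n} (λ (j k : Fin n) → w (+ ∣ toℕ j - toℕ k ∣))
      ≈ lucasU R (1# - (A - ε * B) * (A - ε * B))
                 ((B * B) * ((1# + B - ε * A) * (1# + B - ε * A))) n
corollary1p7 R A B ε ε≈±1 w w₋₁≈ε w₀≈1 recurrence (suc m) _ = begin
  det R (leading (suc m) T)                                    ≈⟨ det-band (suc m) T ⟨
  det R (leading (suc m) Q)                                    ≈⟨ det-transpose (leading (suc m) Q) ⟨
  det R (leading (suc m) (transpose Q))                        ≈⟨ det-band (suc m) (transpose Q) ⟨
  det R (leading (suc m) P)                                    ≈⟨ det-leading-cong (suc m) (λ j _ k → P≈tridiagonal j k) ⟩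
  det R (leading (suc m) (tridiagonal diagonal offDiagonal))   ≈⟨ det-tridiagonal≈lucasU m ⟩
  lucasU R x y (suc m)                                         ∎
  where
  open CommutativeRing R using (setoid; -_)
  open import Relation.Binary.Reasoning.Setoid setoid
  open Determinants R using (det-transpose)
  open RowOperations R using (leading; det-leading-cong)
  open Tridiagonal R using (tridiagonal)
  open LucasToeplitz.Reduction R A B ε ε≈±1 w w₋₁≈ε w₀≈1 recurrence
  open BandReduction R (- A) B using (det-band; transpose)
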